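{- Let $L$ be a proper unimodular $\mathbb{Z}_2$-lattice of rank exceeding $4$. Then $L$ is primitively $\mathbb{Z}_2$-universal.
   Context: A $\mathbb{Z}_2$-lattice is a finitely generated $\mathbb{Z}_2$-submodule of a nondegenerate quadratic space over $\mathbb{Q}_2$ with quadratic map $q$. A proper unimodular $\mathbb{Z}_2$-lattice of rank $n$ is one having an orthogonal basis $v_1,\ldots,v_n$ with all $q(v_i)\in\mathbb{Z}_2^\times$. A vector $v\in L$ is primitive if $\{\alpha\in\mathbb{Q}_2:\alpha v\in L\}=\mathbb{Z}_2$. $L$ is primitively $\mathbb{Z}_2$-universal if every nonzero $\alpha\in\mathbb{Z}_2$ equals $q(v)$ for some primitive $v\in L$. -}

module Defs where

open import Data.Nat using (ℕ; zero; suc; _+_; _*_; _^_; _<_; _%_)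
open import Data.Nat.Properties using (m^n≢0)
open import Data.Fin using (Fin; zero; suc)
open import Data.Product using (Σ; ∃; _×_)
open import Relation.Binary.PropositionalEquality using (_≡_; _≢_)

_mod2^_ : ℕ → ℕ → ℕ
m mod2^ k = _%_ m (2 ^ k) {{m^n≢0 2 k}}

-- The 2-adic integers ℤ₂ = lim ℤ/2^k ℤ, an element being a coherent
-- sequence of residues: res k ∈ {0,…,2^k - 1} is the element mod 2^k.
record ℤ₂ : Set where
  field
    res     : ℕ → ℕ
    res-<   : ∀ k → res k < 2 ^ k
    res-coh : ∀ k → res (suc k) mod2^ k ≡ res k
open ℤ₂ public

IsUnit : ℤ₂ → Set
IsUnit a = res a 1 ≡ 1

-- α ≠ 0 (constructive apartness from 0: some residue is nonzero).
NonZero₂ : ℤ₂ → Set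
NonZero₂ a = ∃ λ k → res a k ≢ 0

∑ : ∀ n → (Fin n → ℕ) → ℕ
∑ zero    f = 0
∑ (suc n) f = f zero + ∑ n (λ i → f (suc i))

-- The proper unimodular lattice L with orthogonal basis v₁,…,vₙ, q(vᵢ) = u i,
-- is identified with ℤ₂ⁿ via coordinates.  q(Σ xᵢ vᵢ) = Σ u i · xᵢ², and
-- "q(x) = α" holds iff it holds modulo every 2^k (residue maps are ring maps).
QEq : ∀ n → (Fin n → ℤ₂) → (Fin n → ℤ₂) → ℤ₂ → Set
QEq n u x α = ∀ k → ∑ n (λ i → res (u i) k * (res (x i) k * res (x i) k)) mod2^ k ≡ res α k

-- Primitive vector x ∈ L: every α ∈ ℚ₂ with α x ∈ L lies in ℤ₂.
-- Each α ∈ ℚ₂ is written a / 2^j with a ∈ ℤ₂, j ∈ ℕ; "α x ∈ L" means there is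
-- w ∈ L = ℤ₂ⁿ with 2^j · w = a · x; "α ∈ ℤ₂" means a = 2^j · b for some b ∈ ℤ₂.
Primitive : ∀ n → (Fin n → ℤ₂) → Set
Primitive n x =
  ∀ (j : ℕ) (a : ℤ₂) →
  (Σ (Fin n → ℤ₂) λ w → ∀ i k → (2 ^ j * res (w i) k) mod2^ k ≡ (res a k * res (x i) k) mod2^ k) →
  Σ ℤ₂ λ b → ∀ k → res a k ≡ (2 ^ j * res b k) mod2^ k

PrimitivelyUniversal : ∀ n → (Fin n → ℤ₂) → Set
PrimitivelyUniversal n u =
  ∀ (α : ℤ₂) → NonZero₂ α → Σ (Fin n → ℤ₂) λ x → Primitive n x × QEq n u x α

module Submission where

-- To represent α primitively we look for
-- x = (x₀, c₁, …, c₄, 0, …, 0) with x₀ a unit and cᵢ ∈ {0, 1, 2}: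
--   * a vector with a unit coordinate is primitive;
--   * four odd weights reach every residue mod 8 with coefficients in {0,1,2}
--     (a finite check), so the cᵢ can be chosen with q(1, c) ≡ α (mod 8);
--   * Hensel's lemma for x₀ ↦ u₀x₀² + C: if t is odd and u₀t² + C ≡ α mod 2^(3+k),
--     then t or t + 2^(2+k) works mod 2^(4+k); iterating from t = 1 yields a
--     coherent sequence of residues, i.e. a unit x₀ ∈ ℤ₂ with u₀x₀² + C = α.

open import Defs
open import Data.Nat using (ℕ; zero; suc; _+_; _*_; _^_; _<_; _/_; NonZero; s≤s; _≟_)
open import Data.Nat.Properties
open import Data.Nat.DivMod
open import Data.Nat.Divisibility
open import Data.Nat.Tactic.RingSolver using (solve-∀)
open import Data.Fin using (Fin; zero; suc; _↑ˡ_)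
open import Data.Vec.Functional using (_∷_; [])
open import Data.Product using (Σ; _×_; _,_; proj₁; proj₂)
open import Data.Sum using (_⊎_; inj₁; inj₂)
open import Data.Empty using (⊥-elim)
open import Data.List using (upTo)
open import Data.List.Relation.Unary.All using (All; all?; lookup)
open import Data.List.Relation.Unary.Any using (Any; any?; satisfied)
open import Data.List.Membership.Propositional using (_∈_)
open import Data.List.Membership.Propositional.Properties using (∈-upTo⁺)
open import Relation.Nullary using (Dec; yes; no)
open import Relation.Nullary.Decidable using (toWitness; map′; _→-dec_)
open import Relation.Binary using (Setoid)
import Relation.Binary.Reasoning.Setoid as SetoidReasoning
open import Relation.Binary.PropositionalEquality

pow2≢0 : ∀ k → NonZero (2 ^ k)
pow2≢0 k = m^n≢0 2 k

_div2^_ : ℕ → ℕ → ℕ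
N div2^ j = _/_ N (2 ^ j) {{pow2≢0 j}}

-- Congruence modulo 2^k (a record, so that a, b and k are inferable).
infix 4 _≈[_]_
record _≈[_]_ (a k b : ℕ) : Set where
  constructor mk
  field un : a mod2^ k ≡ b mod2^ k
open _≈[_]_ public

≈-refl : ∀ {a k} → a ≈[ k ] a
≈-refl = mk refl

≈-sym : ∀ {a b k} → a ≈[ k ] b → b ≈[ k ] a
≈-sym (mk p) = mk (sym p)

≈-trans : ∀ {a b c k} → a ≈[ k ] b → b ≈[ k ] c → a ≈[ k ] c
≈-trans (mk p) (mk q) = mk (trans p q)

≡⇒≈ : ∀ {a b k} → a ≡ b → a ≈[ k ] b
≡⇒≈ refl = ≈-refl

≈-setoid : ℕ → Setoid _ _
≈-setoid k = record
  { Carrier = ℕ ; _≈_ = _≈[ k ]_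
  ; isEquivalence = record { refl = ≈-refl ; sym = ≈-sym ; trans = ≈-trans } }

module ≈-Reasoning (k : ℕ) = SetoidReasoning (≈-setoid k)

mod2^-< : ∀ a k → a mod2^ k < 2 ^ k
mod2^-< a k = m%n<n a (2 ^ k) {{pow2≢0 k}}

mod2^-small : ∀ {a k} → a < 2 ^ k → a mod2^ k ≡ a
mod2^-small {k = k} = m<n⇒m%n≡m {{pow2≢0 k}}

mod2^-≈ : ∀ a k → a mod2^ k ≈[ k ] a
mod2^-≈ a k = mk (m%n%n≡m%n a (2 ^ k) {{pow2≢0 k}})

pow2-∣ : ∀ d m → 2 ^ m ∣ 2 ^ (d + m)
pow2-∣ d m = subst (2 ^ m ∣_) (sym (^-distribˡ-+-* 2 d m)) (n∣m*n (2 ^ d))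

mod2^-mod2^ : ∀ d m a → (a mod2^ (d + m)) mod2^ m ≡ a mod2^ m
mod2^-mod2^ d m a =
  m∣n⇒o%n%m≡o%m (2 ^ m) (2 ^ (d + m)) a {{pow2≢0 m}} {{pow2≢0 (d + m)}} (pow2-∣ d m)

+-multiple-≈ : ∀ a {b} k → 2 ^ k ∣ b → a + b ≈[ k ] a
+-multiple-≈ a k d = mk (%-remove-+ʳ a {{pow2≢0 k}} d)

weaken : ∀ d {m a b} → a ≈[ d + m ] b → a ≈[ m ] b
weaken d {m} {a} {b} (mk p) = mk (begin
  a mod2^ m                 ≡⟨ mod2^-mod2^ d m a ⟨
  (a mod2^ (d + m)) mod2^ m ≡⟨ cong (_mod2^ m) p ⟩
  (b mod2^ (d + m)) mod2^ m ≡⟨ mod2^-mod2^ d m b ⟩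
  b mod2^ m                 ∎)
  where open ≡-Reasoning

+-≈ : ∀ {a b c d k} → a ≈[ k ] b → c ≈[ k ] d → a + c ≈[ k ] b + d
+-≈ {a} {b} {c} {d} {k} (mk p) (mk q) = mk (begin
  (a + c) mod2^ k                 ≡⟨ %-distribˡ-+ a c (2 ^ k) {{pow2≢0 k}} ⟩
  (a mod2^ k + c mod2^ k) mod2^ k ≡⟨ cong₂ (λ x y → (x + y) mod2^ k) p q ⟩
  (b mod2^ k + d mod2^ k) mod2^ k ≡⟨ %-distribˡ-+ b d (2 ^ k) {{pow2≢0 k}} ⟨
  (b + d) mod2^ k                 ∎)
  where open ≡-Reasoning

*-≈ : ∀ {a b c d k} → a ≈[ k ] b → c ≈[ k ] d → a * c ≈[ k ] b * d
*-≈ {a} {b} {c} {d} {k} (mk p) (mk q) = mk (begin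
  (a * c) mod2^ k                   ≡⟨ %-distribˡ-* a c (2 ^ k) {{pow2≢0 k}} ⟩
  (a mod2^ k * (c mod2^ k)) mod2^ k ≡⟨ cong₂ (λ x y → (x * y) mod2^ k) p q ⟩
  (b mod2^ k * (d mod2^ k)) mod2^ k ≡⟨ %-distribˡ-* b d (2 ^ k) {{pow2≢0 k}} ⟨
  (b * d) mod2^ k                   ∎)
  where open ≡-Reasoning

_≈?[_]_ : ∀ a k b → Dec (a ≈[ k ] b)
a ≈?[ k ] b = map′ mk un (a mod2^ k ≟ b mod2^ k)

top-digit : ∀ m r → r < 2 ^ suc m → r ≡ r mod2^ m ⊎ r ≡ r mod2^ m + 2 ^ m
top-digit m r r< =
  digit (r div2^ m)
        (m<n*o⇒m/o<n {r} {2} {2 ^ m} {{pow2≢0 m}} r<)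
        (m≡m%n+[m/n]*n r (2 ^ m) {{pow2≢0 m}})
  where
  digit : ∀ q → q < 2 → r ≡ r mod2^ m + q * 2 ^ m → r ≡ r mod2^ m ⊎ r ≡ r mod2^ m + 2 ^ m
  digit 0 _ e = inj₁ (trans e (+-identityʳ _))
  digit 1 _ e = inj₂ (trans e (cong (r mod2^ m +_) (+-identityʳ _)))
  digit (suc (suc _)) (s≤s (s≤s ())) _

≈-refine : ∀ m {a b} → a ≈[ m ] b → a ≈[ suc m ] b ⊎ a + 2 ^ m ≈[ suc m ] b
≈-refine m {a} {b} (mk a≡b) =
  cases (normalise (mod2^-mod2^ 1 m a) (top-digit m a′ (mod2^-< a (suc m))))
        (normalise (trans (mod2^-mod2^ 1 m b) (sym a≡b)) (top-digit m b′ (mod2^-< b (suc m))))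
  where
  open ≈-Reasoning (suc m)
  a′ b′ r : ℕ
  a′ = a mod2^ suc m
  b′ = b mod2^ suc m
  r = a mod2^ m
  Lifts-r : ℕ → Set
  Lifts-r s = s ≡ r ⊎ s ≡ r + 2 ^ m
  normalise : ∀ {s} → s mod2^ m ≡ r → s ≡ s mod2^ m ⊎ s ≡ s mod2^ m + 2 ^ m → Lifts-r s
  normalise e (inj₁ p) = inj₁ (trans p e)
  normalise e (inj₂ p) = inj₂ (trans p (cong (_+ 2 ^ m) e))
  a≈a′ : a ≈[ suc m ] a′
  a≈a′ = ≈-sym (mod2^-≈ a (suc m))
  b′≈b : b′ ≈[ suc m ] b
  b′≈b = mod2^-≈ b (suc m)
  same : ∀ {s} → a′ ≡ s → b′ ≡ s → a ≈[ suc m ] b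
  same p q = ≈-trans a≈a′ (≈-trans (≡⇒≈ (trans p (sym q))) b′≈b)
  cases : Lifts-r a′ → Lifts-r b′ → a ≈[ suc m ] b ⊎ a + 2 ^ m ≈[ suc m ] b
  cases (inj₁ p) (inj₁ q) = inj₁ (same p q)
  cases (inj₂ p) (inj₂ q) = inj₁ (same p q)
  cases (inj₁ p) (inj₂ q) = inj₂ (begin
    a + 2 ^ m  ≈⟨ +-≈ a≈a′ ≈-refl ⟩
    a′ + 2 ^ m ≡⟨ cong (_+ 2 ^ m) p ⟩
    r + 2 ^ m  ≡⟨ q ⟨
    b′         ≈⟨ b′≈b ⟩
    b          ∎)
  cases (inj₂ p) (inj₁ q) = inj₂ (begin
    a + 2 ^ m               ≈⟨ +-≈ a≈a′ ≈-refl ⟩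
    a′ + 2 ^ m              ≡⟨ cong (_+ 2 ^ m) p ⟩
    r + 2 ^ m + 2 ^ m       ≡⟨ +-assoc r (2 ^ m) (2 ^ m) ⟩
    r + (2 ^ m + 2 ^ m)     ≡⟨ cong (λ z → r + (2 ^ m + z)) (+-identityʳ (2 ^ m)) ⟨
    r + 2 ^ suc m           ≈⟨ +-multiple-≈ r (suc m) ∣-refl ⟩
    r                       ≡⟨ q ⟨
    b′                      ≈⟨ b′≈b ⟩
    b                       ∎)

Odd : ℕ → Set
Odd a = a mod2^ 1 ≡ 1

odd-* : ∀ a b → Odd a → Odd b → Odd (a * b)
odd-* a b ha hb = un (*-≈ {a} {1} {b} {1} {1} (mk ha) (mk hb))

odd-+-pow2 : ∀ j t → Odd t → Odd (t + 2 ^ suc j)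
odd-+-pow2 j t ht = trans (un (+-multiple-≈ t 1 (divides (2 ^ j) (*-comm 2 (2 ^ j))))) ht

diag : ∀ n → (Fin n → ℕ) → (Fin n → ℕ) → ℕ
diag n w c = ∑ n (λ i → w i * (c i * c i))

diag-≈ : ∀ n {k} {w w′ c c′ : Fin n → ℕ} →
  (∀ i → w i ≈[ k ] w′ i) → (∀ i → c i ≈[ k ] c′ i) → diag n w c ≈[ k ] diag n w′ c′
diag-≈ zero hw hc = ≈-refl
diag-≈ (suc n) hw hc =
  +-≈ (*-≈ (hw zero) (*-≈ (hc zero) (hc zero))) (diag-≈ n (λ i → hw (suc i)) (λ i → hc (suc i)))

diag-zero : ∀ n (w : Fin n → ℕ) → diag n w (λ _ → 0) ≡ 0
diag-zero zero w = refl
diag-zero (suc n) w = cong₂ _+_ (*-zeroʳ (w zero)) (diag-zero n (λ i → w (suc i)))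

pad : ∀ {m} r → (Fin m → ℕ) → Fin (m + r) → ℕ
pad {zero} r c i = 0
pad {suc m} r c zero = c zero
pad {suc m} r c (suc i) = pad r (λ j → c (suc j)) i

diag-pad : ∀ m r (w : Fin (m + r) → ℕ) (c : Fin m → ℕ) →
  diag (m + r) w (pad r c) ≡ diag m (λ i → w (i ↑ˡ r)) c
diag-pad zero r w c = diag-zero r w
diag-pad (suc m) r w c =
  cong (w zero * (c zero * c zero) +_) (diag-pad m r (λ i → w (suc i)) (λ i → c (suc i)))

Coherent : (ℕ → ℕ) → Set
Coherent f = ∀ m → f (suc m) ≈[ m ] f m

coherent-≈ : ∀ {f} → Coherent f → ∀ d m → f (d + m) ≈[ m ] f m
coherent-≈ coh zero m = ≈-refl
coherent-≈ coh (suc d) m = ≈-trans (weaken d (coh (d + m))) (coherent-≈ coh d m)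

res-coherent : ∀ x → Coherent (res x)
res-coherent x m = mk (trans (res-coh x m) (sym (mod2^-small {k = m} (res-< x m))))

fromCoherent : (f : ℕ → ℕ) → Coherent f → ℤ₂
res (fromCoherent f _) m = f m mod2^ m
res-< (fromCoherent f _) m = mod2^-< (f m) m
res-coh (fromCoherent f coh) m = trans (mod2^-mod2^ 1 m (f (suc m))) (un (coh m))

unit-odd : ∀ x → IsUnit x → ∀ k → Odd (res x (suc k))
unit-odd x hx k with un (coherent-≈ (res-coherent x) k 1)
... | e rewrite +-comm k 1 | hx = e

even-factor : ∀ A X → Odd X → 2 ∣ A * X → 2 ∣ A
even-factor A X hX AX-even = by-parity (A % 2) refl (m%n<n A 2)
  where
  by-parity : ∀ r → A % 2 ≡ r → r < 2 → 2 ∣ A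
  by-parity 0 e _ = m%n≡0⇒n∣m A 2 e
  by-parity 1 e _ with trans (sym (odd-* A X e hX)) (n∣m⇒m%n≡0 (A * X) 2 AX-even)
  ... | ()
  by-parity (suc (suc _)) _ (s≤s (s≤s ()))

odd-cancel : ∀ j A X → Odd X → 2 ^ j ∣ A * X → 2 ^ j ∣ A
odd-cancel zero A X hX d = 1∣ A
odd-cancel (suc j) A X hX d with even-factor A X hX (∣-trans (m∣m*n (2 ^ j)) d)
... | divides q refl =
  subst (2 ^ suc j ∣_) (*-comm 2 q)
    (*-monoʳ-∣ 2 (odd-cancel j q X hX (*-cancelˡ-∣ 2 (subst (2 ^ suc j ∣_) regroup d))))
  where
  regroup : q * 2 * X ≡ 2 * (q * X)
  regroup = trans (cong (_* X) (*-comm q 2)) (*-assoc 2 q X)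

div2^-mod2^ : ∀ j N k → (N div2^ j) mod2^ k ≡ (N mod2^ (k + j)) div2^ j
div2^-mod2^ j N k =
  trans (sym (m%[n*o]/o≡m/o%n N (2 ^ k) (2 ^ j) {{pow2≢0 k}} {{pow2≢0 j}} {{2^k*2^j≢0}}))
        (cong (_div2^ j) (%-congʳ {{2^k*2^j≢0}} {{pow2≢0 (k + j)}} (sym (^-distribˡ-+-* 2 k j))))
  where
  2^k*2^j≢0 : NonZero (2 ^ k * 2 ^ j)
  2^k*2^j≢0 = m*n≢0 (2 ^ k) (2 ^ j) {{pow2≢0 k}} {{pow2≢0 j}}

scaled-divisible : ∀ x → IsUnit x → ∀ j k A W →
  (2 ^ j * W) mod2^ (k + j) ≡ (A * res x (k + j)) mod2^ (k + j) → 2 ^ j ∣ A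
scaled-divisible x ux zero k A W _ = 1∣ A
scaled-divisible x ux (suc j) k A W h = odd-cancel (suc j) A (res x (k + suc j)) x-odd Ax-divisible
  where
  x-odd : Odd (res x (k + suc j))
  x-odd rewrite +-suc k j = unit-odd x ux (k + j)
  Ax-divisible : 2 ^ suc j ∣ A * res x (k + suc j)
  Ax-divisible =
    ∣n∣m%n⇒∣m {{pow2≢0 (k + suc j)}} (pow2-∣ k (suc j))
      (subst (2 ^ suc j ∣_) h (%-presˡ-∣ {{pow2≢0 (k + suc j)}} (m∣m*n W) (pow2-∣ k (suc j))))

-- A vector with a unit coordinate xᵢ is primitive: if 2^j w = a x, then at each level
-- 2^j divides the residue of a (from coordinate i), and the quotients a / 2^j form
-- a coherent sequence, i.e. a 2-adic integer b with a = 2^j b.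
unit-coordinate⇒primitive : ∀ n (x : Fin n → ℤ₂) (i : Fin n) → IsUnit (x i) → Primitive n x
unit-coordinate⇒primitive n x i ux j a (w , hw) = b , a≡2^j*b
  where
  quot : ℕ → ℕ
  quot k = res a (k + j) div2^ j
  quot-small : ∀ k → quot k mod2^ k ≡ quot k
  quot-small k =
    trans (div2^-mod2^ j (res a (k + j)) k)
          (cong (_div2^ j) (mod2^-small {k = k + j} (res-< a (k + j))))
  quot-coherent : Coherent quot
  quot-coherent k = mk (begin
    quot (suc k) mod2^ k                      ≡⟨ div2^-mod2^ j (res a (suc k + j)) k ⟩
    (res a (suc (k + j)) mod2^ (k + j)) div2^ j ≡⟨ cong (_div2^ j) (res-coh a (k + j)) ⟩
    quot k                                    ≡⟨ quot-small k ⟨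
    quot k mod2^ k                            ∎)
    where open ≡-Reasoning
  b : ℤ₂
  b = fromCoherent quot quot-coherent
  divisible : ∀ k → 2 ^ j ∣ res a (k + j)
  divisible k = scaled-divisible (x i) ux j k (res a (k + j)) (res (w i) (k + j)) (hw i (k + j))
  a≡2^j*b : ∀ k → res a k ≡ (2 ^ j * res b k) mod2^ k
  a≡2^j*b k = sym (begin
    (2 ^ j * res b k) mod2^ k ≡⟨ cong (λ z → (2 ^ j * z) mod2^ k) (quot-small k) ⟩
    (2 ^ j * quot k) mod2^ k  ≡⟨ cong (_mod2^ k) (m*[n/m]≡n {{pow2≢0 j}} (divisible k)) ⟩
    res a (k + j) mod2^ k     ≡⟨ un (subst (λ l → res a l ≈[ k ] res a k) (+-comm j k)
                                        (coherent-≈ (res-coherent a) j k)) ⟩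
    res a k mod2^ k           ≡⟨ mod2^-small {k = k} (res-< a k) ⟩
    res a k                   ∎)
    where open ≡-Reasoning

pow2-*-odd : ∀ p x → Odd x → 2 ^ p * x ≈[ suc p ] 2 ^ p
pow2-*-odd p x hx = begin
  2 ^ p * x                       ≡⟨ cong (2 ^ p *_) x≡1+2h ⟩
  2 ^ p * (1 + x / 2 * 2)         ≡⟨ expand (2 ^ p) (x / 2) ⟩
  2 ^ p + x / 2 * (2 * 2 ^ p)     ≈⟨ +-multiple-≈ (2 ^ p) (suc p) (n∣m*n (x / 2)) ⟩
  2 ^ p                           ∎
  where
  open ≈-Reasoning (suc p)
  x≡1+2h : x ≡ 1 + x / 2 * 2
  x≡1+2h = trans (m≡m%n+[m/n]*n x 2) (cong (_+ x / 2 * 2) hx)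
  expand : ∀ P h → P * (1 + h * 2) ≡ P + h * (2 * P)
  expand = solve-∀

-- Hensel step: (t + 2^(2+k))² = t² + 2^(3+k)·t + 2^(4+2k), so for odd U and t the
-- correction by 2^(2+k) changes U t² + C by exactly 2^(3+k) modulo 2^(4+k).
hensel-step : ∀ k U t C → Odd U → Odd t →
  U * ((t + 2 ^ (2 + k)) * (t + 2 ^ (2 + k))) + C ≈[ 4 + k ] (U * (t * t) + C) + 2 ^ (3 + k)
hensel-step k U t C hU ht = begin
  U * ((t + 2 ^ (2 + k)) * (t + 2 ^ (2 + k))) + C
    ≡⟨ expand U t C (2 ^ k) ⟩
  (U * (t * t) + C) + (2 ^ (3 + k) * (U * t) + 2 ^ (4 + k) * (2 ^ k * U))
    ≈⟨ +-≈ ≈-refl (+-multiple-≈ (2 ^ (3 + k) * (U * t)) (4 + k) (m∣m*n (2 ^ k * U))) ⟩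
  (U * (t * t) + C) + 2 ^ (3 + k) * (U * t)
    ≈⟨ +-≈ ≈-refl (pow2-*-odd (3 + k) (U * t) (odd-* U t hU ht)) ⟩
  (U * (t * t) + C) + 2 ^ (3 + k) ∎
  where
  open ≈-Reasoning (4 + k)
  expand : ∀ U t C p → U * ((t + 2 * (2 * p)) * (t + 2 * (2 * p))) + C ≡
    (U * (t * t) + C) + (2 * (2 * (2 * p)) * (U * t) + 2 * (2 * (2 * (2 * p))) * (p * U))
  expand = solve-∀

-- Hensel's lemma for U x² + C = A, the data given as coherent residue sequences with
-- U odd: a solution x = 1 modulo 8 lifts to a unit 2-adic root.
module HenselLift (U C A : ℕ → ℕ) (U-coh : Coherent U) (C-coh : Coherent C) (A-coh : Coherent A)
                  (U-odd : ∀ k → Odd (U (suc k))) (base : U 3 * 1 + C 3 ≈[ 3 ] A 3) where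

  Q : ℕ → ℕ → ℕ
  Q j t = U j * (t * t) + C j

  Q-coherent : ∀ d m t → Q (d + m) t ≈[ m ] Q m t
  Q-coherent d m t = +-≈ (*-≈ (coherent-≈ U-coh d m) ≈-refl) (coherent-≈ C-coh d m)

  lift : ℕ → ℕ → ℕ
  lift k t with Q (4 + k) t ≈?[ 4 + k ] A (4 + k)
  ... | yes _ = t
  ... | no _ = t + 2 ^ (2 + k)

  lift-≈ : ∀ k t → lift k t ≈[ 2 + k ] t
  lift-≈ k t with Q (4 + k) t ≈?[ 4 + k ] A (4 + k)
  ... | yes _ = ≈-refl
  ... | no _ = +-multiple-≈ t (2 + k) ∣-refl

  Solves : ℕ → ℕ → Set
  Solves k t = Odd t × Q (3 + k) t ≈[ 3 + k ] A (3 + k)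

  -- The Hensel step: a solution mod 2^(3+k) is a solution mod 2^(4+k) up to the
  -- digit 2^(3+k), which the correction by 2^(2+k) removes.
  lift-solves : ∀ k t → Solves k t → Solves (suc k) (lift k t)
  lift-solves k t (t-odd , sol) with Q (4 + k) t ≈?[ 4 + k ] A (4 + k)
  ... | yes sol′ = t-odd , sol′
  ... | no ¬sol′ with ≈-refine (3 + k) sol-at-next-level
    where
    sol-at-next-level : Q (4 + k) t ≈[ 3 + k ] A (4 + k)
    sol-at-next-level =
      ≈-trans (Q-coherent 1 (3 + k) t) (≈-trans sol (≈-sym (coherent-≈ A-coh 1 (3 + k))))
  ... | inj₁ sol′ = ⊥-elim (¬sol′ sol′)
  ... | inj₂ sol′ =
    odd-+-pow2 (1 + k) t t-odd ,
    ≈-trans (hensel-step k (U (4 + k)) t (C (4 + k)) (U-odd (3 + k)) t-odd) sol′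

  approx : ℕ → ℕ
  approx zero = 1
  approx (suc k) = lift k (approx k)

  approx-solves : ∀ k → Solves k (approx k)
  approx-solves zero = refl , base
  approx-solves (suc k) = lift-solves k (approx k) (approx-solves k)

  root : ℤ₂
  root = fromCoherent approx (λ m → weaken 2 (lift-≈ m (approx m)))

  root-unit : IsUnit root
  root-unit = proj₁ (approx-solves 1)

  root-solves : ∀ m → U m * (res root m * res root m) + C m ≈[ m ] A m
  root-solves m = begin
    U m * (res root m * res root m) + C m ≈⟨ +-≈ (*-≈ (≈-refl {U m}) (*-≈ t≈ t≈)) (≈-refl {C m}) ⟩
    Q m (approx m)                        ≈⟨ Q-coherent 3 m (approx m) ⟨
    Q (3 + m) (approx m)                  ≈⟨ weaken 3 (proj₂ (approx-solves m)) ⟩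
    A (3 + m)                             ≈⟨ coherent-≈ A-coh 3 m ⟩
    A m                                   ∎
    where
    open ≈-Reasoning m
    t≈ : res root m ≈[ m ] approx m
    t≈ = mod2^-≈ (approx m) m

lift-first-coordinate : ∀ n (u : Fin (suc n) → ℤ₂) → IsUnit (u zero) → (c : Fin n → ℕ) (α : ℤ₂) →
  res (u zero) 3 + diag n (λ i → res (u (suc i)) 3) c ≈[ 3 ] res α 3 →
  Σ (Fin (suc n) → ℤ₂) λ x → Primitive (suc n) x × QEq (suc n) u x α
lift-first-coordinate n u u₀-unit c α mod8 = x , x-primitive , x-represents
  where
  C : ℕ → ℕ
  C m = diag n (λ i → res (u (suc i)) m) c
  C-coherent : Coherent C
  C-coherent m = diag-≈ n {c = c} {c′ = c} (λ i → res-coherent (u (suc i)) m) (λ _ → ≈-refl)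
  open HenselLift (res (u zero)) C (res α) (res-coherent (u zero)) C-coherent (res-coherent α)
                  (unit-odd (u zero) u₀-unit)
                  (≈-trans (≡⇒≈ (cong (_+ C 3) (*-identityʳ (res (u zero) 3)))) mod8)
  x : Fin (suc n) → ℤ₂
  x = root ∷ (λ i → fromCoherent (λ _ → c i) (λ _ → ≈-refl))
  x-primitive : Primitive (suc n) x
  x-primitive = unit-coordinate⇒primitive (suc n) x zero root-unit
  x-represents : QEq (suc n) u x α
  x-represents m = trans (un represents-mod) (mod2^-small {k = m} (res-< α m))
    where
    represents-mod : diag (suc n) (λ i → res (u i) m) (λ i → res (x i) m) ≈[ m ] res α m
    represents-mod =
      ≈-trans (+-≈ ≈-refl (diag-≈ n {w = w} {w′ = w} (λ _ → ≈-refl) (λ i → mod2^-≈ (c i) m)))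
              (root-solves m)
      where
      w : Fin n → ℕ
      w i = res (u (suc i)) m

Reachable : ℕ → ℕ → ℕ → ℕ → ℕ → Set
Reachable b w₀ w₁ w₂ w₃ =
  Any (λ c₀ → Any (λ c₁ → Any (λ c₂ → Any (λ c₃ →
    diag 4 (w₀ ∷ w₁ ∷ w₂ ∷ w₃ ∷ []) (c₀ ∷ c₁ ∷ c₂ ∷ c₃ ∷ []) ≈[ 3 ] b)
    (upTo 3)) (upTo 3)) (upTo 3)) (upTo 3)

reachable? : ∀ b w₀ w₁ w₂ w₃ → Dec (Reachable b w₀ w₁ w₂ w₃)
reachable? b w₀ w₁ w₂ w₃ =
  any? (λ c₀ → any? (λ c₁ → any? (λ c₂ → any? (λ c₃ →
    diag 4 (w₀ ∷ w₁ ∷ w₂ ∷ w₃ ∷ []) (c₀ ∷ c₁ ∷ c₂ ∷ c₃ ∷ []) ≈?[ 3 ] b)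
    (upTo 3)) (upTo 3)) (upTo 3)) (upTo 3)

reachable-witness : ∀ b w₀ w₁ w₂ w₃ → Reachable b w₀ w₁ w₂ w₃ →
  Σ (Fin 4 → ℕ) λ c → diag 4 (w₀ ∷ w₁ ∷ w₂ ∷ w₃ ∷ []) c ≈[ 3 ] b
reachable-witness b w₀ w₁ w₂ w₃ r₀ =
  let (c₀ , r₁) = satisfied r₀ ; (c₁ , r₂) = satisfied r₁
      (c₂ , r₃) = satisfied r₂ ; (c₃ , e) = satisfied r₃
  in (c₀ ∷ c₁ ∷ c₂ ∷ c₃ ∷ []) , e

odd? : ∀ w → Dec (Odd w)
odd? w = w mod2^ 1 ≟ 1

abstract
  mod8-table : All (λ b → All (λ w₀ → All (λ w₁ → All (λ w₂ → All (λ w₃ →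
      Odd w₀ → Odd w₁ → Odd w₂ → Odd w₃ → Reachable b w₀ w₁ w₂ w₃)
      (upTo 8)) (upTo 8)) (upTo 8)) (upTo 8)) (upTo 8)
  mod8-table = toWitness {a? = all? (λ b → all? (λ w₀ → all? (λ w₁ → all? (λ w₂ → all? (λ w₃ →
      odd? w₀ →-dec (odd? w₁ →-dec (odd? w₂ →-dec (odd? w₃ →-dec reachable? b w₀ w₁ w₂ w₃))))
      (upTo 8)) (upTo 8)) (upTo 8)) (upTo 8)) (upTo 8)} _

odd-weights-mod8 : ∀ b (w : Fin 4 → ℕ) → (∀ i → Odd (w i)) →
  Σ (Fin 4 → ℕ) λ c → diag 4 w c ≈[ 3 ] b
odd-weights-mod8 b w w-odd = c , (begin
  diag 4 w c    ≈⟨ diag-≈ 4 {c = c} {c′ = c} (λ i → ≈-sym (mod2^-≈ (w i) 3)) (λ _ → ≈-refl) ⟩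
  diag 4 r c    ≈⟨ proj₂ witness ⟩
  b mod2^ 3     ≈⟨ mod2^-≈ b 3 ⟩
  b             ∎)
  where
  open ≈-Reasoning 3
  r : Fin 4 → ℕ
  r i = w i mod2^ 3
  r∈ : ∀ i → r i ∈ upTo 8
  r∈ i = ∈-upTo⁺ (mod2^-< (w i) 3)
  r-odd : ∀ i → Odd (r i)
  r-odd i = trans (mod2^-mod2^ 2 1 (w i)) (w-odd i)
  i₀ i₁ i₂ i₃ : Fin 4
  i₀ = zero
  i₁ = suc zero
  i₂ = suc (suc zero)
  i₃ = suc (suc (suc zero))
  witness : Σ (Fin 4 → ℕ) λ c → diag 4 (r i₀ ∷ r i₁ ∷ r i₂ ∷ r i₃ ∷ []) c ≈[ 3 ] b mod2^ 3
  witness = reachable-witness (b mod2^ 3) (r i₀) (r i₁) (r i₂) (r i₃)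
    (lookup (lookup (lookup (lookup (lookup mod8-table (∈-upTo⁺ (mod2^-< b 3)))
      (r∈ i₀)) (r∈ i₁)) (r∈ i₂)) (r∈ i₃) (r-odd i₀) (r-odd i₁) (r-odd i₂) (r-odd i₃))
  c : Fin 4 → ℕ
  c = proj₁ witness

-- Write n = 1 + (4 + r); choose c₁,…,c₄ with u₁c₁² + ⋯ + u₄c₄² ≡ α − u₀ (mod 8), pad
-- them by zeros, and lift the first coordinate by Hensel's lemma.
proposition5p6 : ∀ (n : ℕ) → 4 < n → (u : Fin n → ℤ₂) → (∀ i → IsUnit (u i)) →
    PrimitivelyUniversal n u
proposition5p6 _ (s≤s (s≤s (s≤s (s≤s (s≤s {n = r} _))))) u u-unit α _ =
  lift-first-coordinate (4 + r) u (u-unit zero) (pad r c) α mod8-solution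
  where
  U : ℕ
  U = res (u zero) 3
  w : Fin (4 + r) → ℕ
  w i = res (u (suc i)) 3
  -- α − u₀ is represented as α + 7u₀ to stay within ℕ
  coefficients : Σ (Fin 4 → ℕ) λ c → diag 4 (λ i → w (i ↑ˡ r)) c ≈[ 3 ] res α 3 + 7 * U
  coefficients = odd-weights-mod8 (res α 3 + 7 * U) (λ i → w (i ↑ˡ r))
                   (λ i → unit-odd (u (suc (i ↑ˡ r))) (u-unit (suc (i ↑ˡ r))) 2)
  c : Fin 4 → ℕ
  c = proj₁ coefficients
  mod8-solution : U + diag (4 + r) w (pad r c) ≈[ 3 ] res α 3
  mod8-solution = begin
    U + diag (4 + r) w (pad r c)      ≡⟨ cong (U +_) (diag-pad 4 r w c) ⟩
    U + diag 4 (λ i → w (i ↑ˡ r)) c   ≈⟨ +-≈ (≈-refl {U}) (proj₂ coefficients) ⟩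
    U + (res α 3 + 7 * U)             ≡⟨ regroup U (res α 3) ⟩
    res α 3 + 8 * U                   ≈⟨ +-multiple-≈ (res α 3) 3 (m∣m*n U) ⟩
    res α 3                           ∎
    where
    open ≈-Reasoning 3
    regroup : ∀ U a → U + (a + 7 * U) ≡ a + 8 * U
    regroup = solve-∀
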